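{- Let $v$ be a positive integer, let $M$ be an integer with $\frac{v}{2}\left(\frac{v}{2}-1\right)\le M\le\binom{v}{2}$, and let $\mu=\frac{v(v-1)(v-2)}{12M}$. If there exists a uniform nested SQS$(v)$ with exactly $M$ ND-pairs, each of multiplicity $\mu$, then $\mu$ divides $\frac{(v-1)(v-2)}{6}$.
   Context: A Steiner quadruple system SQS$(v)$ is a pair $(Q,\mathcal{B})$ where $Q$ is a set of $v$ points and $\mathcal{B}$ is a collection of 4-subsets of $Q$ (blocks) such that every 3-subset of $Q$ is contained in exactly one block. A nested SQS$(v)$ is an SQS$(v)$ together with a partition of each block into two 2-subsets (pairs). A pair of points is an ND-pair if it is one of the two pairs in the partition of at least one block; the multiplicity of a pair is the number of blocks whose partition contains that pair. A nested SQS is uniform if all its ND-pairs have the same multiplicity. -}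

module Defs where

open import Data.Nat using (ℕ; _≥_)
open import Data.Bool.Properties using () renaming (_≟_ to _≟ᵇ_)
open import Data.Fin using (Fin)
open import Data.Fin.Subset using (Subset; _∪_; _∩_; _⊆_; ∣_∣; Empty)
open import Data.List using (List; filter; length)
open import Data.List.Membership.Propositional using (_∈_)
open import Data.List.Relation.Unary.Unique.Propositional using (Unique)
open import Data.Vec.Properties using (≡-dec)
open import Data.Fin.Properties using () renaming (_≟_ to _≟ᶠ_)
open import Data.Vec.Functional using (Vector)
open import Data.List using (allFin)
open import Data.Product using (Σ; _×_; ∃!)
open import Data.Sum using (_⊎_)
open import Relation.Binary.PropositionalEquality using (_≡_)
open import Relation.Nullary using (Dec)
open import Relation.Nullary.Decidable using (_⊎-dec_)
open import Function.Bundles using (_⇔_)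

_≟ˢ_ : ∀ {v} (P Q : Subset v) → Dec (P ≡ Q)
_≟ˢ_ = ≡-dec _≟ᵇ_

-- A nested block on the point set Fin v: a block {a,b,c,d} together with its
-- partition into two (disjoint) 2-subsets.  The block itself is pair₁ ∪ pair₂.
record NestedBlock (v : ℕ) : Set where
  field
    pair₁ pair₂ : Subset v
    size₁       : ∣ pair₁ ∣ ≡ 2
    size₂       : ∣ pair₂ ∣ ≡ 2
    disjoint    : Empty (pair₁ ∩ pair₂)

  block : Subset v
  block = pair₁ ∪ pair₂

open NestedBlock public

record NestedSQS (v : ℕ) : Set where
  field
    b      : ℕ
    blocks : Vector (NestedBlock v) b
    steiner : ∀ (T : Subset v) → ∣ T ∣ ≡ 3 →
              ∃! _≡_ (λ (i : Fin b) → T ⊆ block (blocks i))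

open NestedSQS public

multiplicity : ∀ {v} (N : NestedSQS v) → Subset v → ℕ
multiplicity N P =
  length (filter (λ i → (pair₁ (blocks N i) ≟ˢ P) ⊎-dec (pair₂ (blocks N i) ≟ˢ P))
                 (allFin (b N)))

IsNDPair : ∀ {v} (N : NestedSQS v) → Subset v → Set
IsNDPair N P = (∣ P ∣ ≡ 2) × (multiplicity N P ≥ 1)

HasNDPairCount : ∀ {v} (N : NestedSQS v) → ℕ → Set
HasNDPairCount {v} N M =
  Σ (List (Subset v)) λ L →
    Unique L × (length L ≡ M) × (∀ P → (P ∈ L) ⇔ IsNDPair N P)

UniformWith : ∀ {v} (N : NestedSQS v) → ℕ → Set
UniformWith N μ = ∀ P → IsNDPair N P → multiplicity N P ≡ μ

-- Fix a point x and let r be the number of blocks through x.  Every ordered pair (y, z) of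
-- distinct points other than x lies in exactly one block through x, and each such block
-- contains 3 · 2 of these pairs, so 6 r = (v − 1)(v − 2).  On the other hand a block through x
-- has exactly one of its two pairs through x, so r is the sum of the multiplicities of the
-- ND-pairs through x, that is r = μ d with d the number of these ND-pairs.

module Submission where

open import Defs
open import Data.Nat using (ℕ; _+_; _*_; _∸_; _≤_; _<_)
open import Data.Nat.Combinatorics using (_C_)
open import Data.Product using (Σ; ∃; ∃!; _×_; _,_; uncurry)
open import Relation.Binary.PropositionalEquality
  using (_≡_; _≢_; refl; sym; trans; cong; cong₂; subst; ≢-sym; module ≡-Reasoning)

open import Data.Bool.Base using (true; false; if_then_else_)
open import Data.Fin.Base using (Fin; zero; suc)
open import Data.Fin.Properties using (suc-injective) renaming (_≟_ to _≟ᶠ_)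
open import Data.Fin.Subset using (Subset; inside; outside; ⊤; ⁅_⁆; _∪_; _∩_; _─_; _-_; ∣_∣; Empty; _∉_)
  renaming (_∈_ to _∈ˢ_; _⊆_ to _⊆ˢ_)
open import Data.Fin.Subset.Properties
  using (_∈?_; ∈⊤; x∈⁅x⁆; x∈⁅y⁆⇒x≡y; x∉⁅y⁆⇒x≢y; x∈p∩q⁺; x∈p∩q⁻; x∈p∪q⁺; x∈p∪q⁻; x∈p∧x≢y⇒x∈p-y; p─q⊆p;
         ∩-idem; Empty-unique; ∣⊥∣≡0; ∣⊤∣≡n; ∣⁅x⁆∣≡1)
open import Data.List.Base using (List; _∷_; length; filter; tabulate; lookup)
open import Data.List.Membership.Propositional using (_∈_)
open import Data.List.Membership.Propositional.Properties using (∈-lookup)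
import Data.List.Relation.Unary.All as All
open import Data.List.Relation.Unary.AllPairs using (_∷_)
open import Data.List.Relation.Unary.Any.Properties using (lookup-index)
open import Data.List.Relation.Unary.Unique.Propositional using (Unique)
open import Data.Nat.Properties
  using (+-*-semiring; +-identityʳ; *-identityˡ; *-identityʳ; *-zeroʳ; *-comm; *-distribˡ-+;
         m≤m+n; m≤n+m; ≤-trans; m+n∸n≡m; ∸-+-assoc; 0≢1+n)
open import Algebra.Properties.Semiring.Sum +-*-semiring
  using (sum; sum-cong-≗; sum-replicate-zero; ∑-distrib-+; ∑-comm; *-distribˡ-sum; *-distribʳ-sum)
open import Data.Nat.Tactic.RingSolver using (solve-∀)
open import Data.Sum using (_⊎_; inj₁; inj₂; [_,_])
open import Data.Vec.Base using ([]; _∷_; here; there)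
open import Function.Base using (_∘_; id)
open import Function.Bundles using (_⇔_; mk⇔; Equivalence)
open import Relation.Binary.Definitions using (DecidableEquality)
open import Relation.Nullary using (Dec; yes; no; does; ¬_; contradiction)
open import Relation.Nullary.Decidable using (_×-dec_; _⊎-dec_; ¬?)
open import Relation.Unary using (Pred; Decidable)

open ≡-Reasoning

𝟙 : ∀ {a} {A : Set a} → Dec A → ℕ
𝟙 a? = if does a? then 1 else 0

module _ {a} {A : Set a} where

  𝟙-yes : (a? : Dec A) → A → 𝟙 a? ≡ 1
  𝟙-yes (yes _) _ = refl
  𝟙-yes (no ¬a) a = contradiction a ¬a

  𝟙-no : (a? : Dec A) → ¬ A → 𝟙 a? ≡ 0
  𝟙-no (yes a) ¬a = contradiction a ¬a
  𝟙-no (no _)  _  = refl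

  𝟙-¬?+𝟙 : (a? : Dec A) → 𝟙 (¬? a?) + 𝟙 a? ≡ 1
  𝟙-¬?+𝟙 (yes _) = refl
  𝟙-¬?+𝟙 (no _)  = refl

module _ {a b} {A : Set a} {B : Set b} where

  𝟙-cong : A ⇔ B → (a? : Dec A) (b? : Dec B) → 𝟙 a? ≡ 𝟙 b?
  𝟙-cong A⇔B (yes a) b? = sym (𝟙-yes b? (Equivalence.to A⇔B a))
  𝟙-cong A⇔B (no ¬a) b? = sym (𝟙-no b? (¬a ∘ Equivalence.from A⇔B))

  𝟙-× : (a? : Dec A) (b? : Dec B) → 𝟙 (a? ×-dec b?) ≡ 𝟙 a? * 𝟙 b?
  𝟙-× (yes _) b? = sym (+-identityʳ (𝟙 b?))
  𝟙-× (no _)  b? = refl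

  𝟙-⊎ : ¬ (A × B) → (a? : Dec A) (b? : Dec B) → 𝟙 (a? ⊎-dec b?) ≡ 𝟙 a? + 𝟙 b?
  𝟙-⊎ ¬a×b (yes a) (yes b) = contradiction (a , b) ¬a×b
  𝟙-⊎ ¬a×b (yes _) (no _)  = refl
  𝟙-⊎ ¬a×b (no _)  b?      = refl

∑-zero : ∀ {n} {f : Fin n → ℕ} → (∀ i → f i ≡ 0) → sum f ≡ 0
∑-zero {n} f≡0 = trans (sum-cong-≗ f≡0) (sum-replicate-zero n)

∑-single : ∀ {n} (f : Fin n → ℕ) j → (∀ i → i ≢ j → f i ≡ 0) → sum f ≡ f j
∑-single f zero    f≡0 =
  trans (cong (f zero +_) (∑-zero (λ i → f≡0 (suc i) λ ()))) (+-identityʳ (f zero))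
∑-single f (suc j) f≡0 =
  cong₂ _+_ (f≡0 zero λ ()) (∑-single (f ∘ suc) j λ i i≢j → f≡0 (suc i) (i≢j ∘ suc-injective))

∑-sift : ∀ {n p} {P : Pred (Fin n) p} (P? : Decidable P) (f : Fin n → ℕ) {j} →
         P j → (∀ {i} → P i → j ≡ i) → sum (λ i → f i * 𝟙 (P? i)) ≡ f j
∑-sift P? f {j} Pj unique = begin
  sum (λ i → f i * 𝟙 (P? i))  ≡⟨ ∑-single _ j off-j ⟩
  f j * 𝟙 (P? j)              ≡⟨ cong (f j *_) (𝟙-yes (P? j) Pj) ⟩
  f j * 1                     ≡⟨ *-identityʳ (f j) ⟩
  f j                         ∎
  where
  off-j : ∀ i → i ≢ j → f i * 𝟙 (P? i) ≡ 0
  off-j i i≢j = trans (cong (f i *_) (𝟙-no (P? i) (i≢j ∘ sym ∘ unique))) (*-zeroʳ (f i))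

∑-≥ : ∀ {n} (f : Fin n → ℕ) j → f j ≤ sum f
∑-≥ f zero    = m≤m+n (f zero) _
∑-≥ f (suc j) = ≤-trans (∑-≥ (f ∘ suc) j) (m≤n+m _ (f zero))

length-filter-tabulate : ∀ {a p n} {A : Set a} {P : Pred A p} (P? : Decidable P) (f : Fin n → A) →
                         length (filter P? (tabulate f)) ≡ sum (λ i → 𝟙 (P? (f i)))
length-filter-tabulate {n = ℕ.zero} P? f = refl
length-filter-tabulate {n = ℕ.suc n} P? f with does (P? (f zero))
... | true  = cong ℕ.suc (length-filter-tabulate P? (f ∘ suc))
... | false = length-filter-tabulate P? (f ∘ suc)

χ : ∀ {n} → Subset n → Fin n → ℕ
χ p x = 𝟙 (x ∈? p)

∣p∣≡∑χ : ∀ {n} (p : Subset n) → ∣ p ∣ ≡ sum (χ p)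
∣p∣≡∑χ []            = refl
∣p∣≡∑χ (inside  ∷ p) = cong ℕ.suc (∣p∣≡∑χ p)
∣p∣≡∑χ (outside ∷ p) = ∣p∣≡∑χ p

x∈p─q⇒x∉q : ∀ {n} {x : Fin n} (p q : Subset n) → x ∈ˢ p ─ q → x ∉ q
x∈p─q⇒x∉q (inside ∷ p) (outside ∷ q) here ()
x∈p─q⇒x∉q (_ ∷ p) (_ ∷ q) (there x∈p─q) (there x∈q) = x∈p─q⇒x∉q p q x∈p─q x∈q

module _ {n : ℕ} where

  χ-∪ : {p q : Subset n} → Empty (p ∩ q) → ∀ x → χ (p ∪ q) x ≡ χ p x + χ q x
  χ-∪ {p} {q} p∩q≡∅ x with x ∈? p | x ∈? q
  ... | yes x∈p | yes x∈q = contradiction (x , x∈p∩q⁺ (x∈p , x∈q)) p∩q≡∅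
  ... | yes x∈p | no _    = 𝟙-yes (x ∈? p ∪ q) (x∈p∪q⁺ (inj₁ x∈p))
  ... | no _    | yes x∈q = 𝟙-yes (x ∈? p ∪ q) (x∈p∪q⁺ (inj₂ x∈q))
  ... | no x∉p  | no x∉q  = 𝟙-no (x ∈? p ∪ q) ([ x∉p , x∉q ] ∘ x∈p∪q⁻ p q)

  ∣p∪q∣≡∣p∣+∣q∣ : {p q : Subset n} → Empty (p ∩ q) → ∣ p ∪ q ∣ ≡ ∣ p ∣ + ∣ q ∣
  ∣p∪q∣≡∣p∣+∣q∣ {p} {q} p∩q≡∅ = begin
    ∣ p ∪ q ∣                    ≡⟨ ∣p∣≡∑χ (p ∪ q) ⟩
    sum (χ (p ∪ q))              ≡⟨ sum-cong-≗ (χ-∪ p∩q≡∅) ⟩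
    sum (λ x → χ p x + χ q x)    ≡⟨ ∑-distrib-+ (χ p) (χ q) ⟩
    sum (χ p) + sum (χ q)        ≡⟨ cong₂ _+_ (∣p∣≡∑χ p) (∣p∣≡∑χ q) ⟨
    ∣ p ∣ + ∣ q ∣                ∎


  x∈p-y⇒x≢y : ∀ (p : Subset n) {x y} → x ∈ˢ p - y → x ≢ y
  x∈p-y⇒x≢y p {y = y} = x∉⁅y⁆⇒x≢y ∘ x∈p─q⇒x∉q p ⁅ y ⁆

  x∈p-y⇔x∈p×x≢y : {p : Subset n} {x y : Fin n} → x ∈ˢ p - y ⇔ (x ∈ˢ p × x ≢ y)
  x∈p-y⇔x∈p×x≢y {p} {x} {y} = mk⇔
    (λ x∈p-y → p─q⊆p p ⁅ y ⁆ x∈p-y , x∈p-y⇒x≢y p x∈p-y)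
    (uncurry x∈p∧x≢y⇒x∈p-y)

  χ-─ : ∀ (p : Subset n) y x → χ (p - y) x ≡ χ p x * 𝟙 (¬? (x ≟ᶠ y))
  χ-─ p y x = trans (𝟙-cong x∈p-y⇔x∈p×x≢y (x ∈? p - y) (x ∈? p ×-dec ¬? (x ≟ᶠ y)))
                    (𝟙-× (x ∈? p) (¬? (x ≟ᶠ y)))

  ∣p∣≡∣p-x∣+χpx : ∀ (p : Subset n) x → ∣ p ∣ ≡ ∣ p - x ∣ + χ p x
  ∣p∣≡∣p-x∣+χpx p x = begin
    ∣ p ∣                                                     ≡⟨ ∣p∣≡∑χ p ⟩
    sum (χ p)                                                 ≡⟨ sum-cong-≗ split ⟩
    sum (λ y → χ (p - x) y + χ p y * 𝟙 (y ≟ᶠ x))              ≡⟨ ∑-distrib-+ (χ (p - x)) _ ⟩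
    sum (χ (p - x)) + sum (λ y → χ p y * 𝟙 (y ≟ᶠ x))
      ≡⟨ cong₂ _+_ (∣p∣≡∑χ (p - x)) (sym (∑-sift (_≟ᶠ x) (χ p) refl sym)) ⟨
    ∣ p - x ∣ + χ p x                                         ∎
    where
    split : ∀ y → χ p y ≡ χ (p - x) y + χ p y * 𝟙 (y ≟ᶠ x)
    split y = begin
      χ p y                                                   ≡⟨ *-identityʳ (χ p y) ⟨
      χ p y * 1                                               ≡⟨ cong (χ p y *_) (𝟙-¬?+𝟙 (y ≟ᶠ x)) ⟨
      χ p y * (𝟙 (¬? (y ≟ᶠ x)) + 𝟙 (y ≟ᶠ x))                  ≡⟨ *-distribˡ-+ (χ p y) _ _ ⟩
      χ p y * 𝟙 (¬? (y ≟ᶠ x)) + χ p y * 𝟙 (y ≟ᶠ x)            ≡⟨ cong (_+ χ p y * 𝟙 (y ≟ᶠ x)) (χ-─ p x y) ⟨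
      χ (p - x) y + χ p y * 𝟙 (y ≟ᶠ x)                        ∎

  ∣p-x∣≡∣p∣∸1 : ∀ {p : Subset n} {x} → x ∈ˢ p → ∣ p - x ∣ ≡ ∣ p ∣ ∸ 1
  ∣p-x∣≡∣p∣∸1 {p} {x} x∈p = begin
    ∣ p - x ∣                ≡⟨ m+n∸n≡m ∣ p - x ∣ 1 ⟨
    ∣ p - x ∣ + 1 ∸ 1        ≡⟨ cong (λ c → ∣ p - x ∣ + c ∸ 1) (𝟙-yes (x ∈? p) x∈p) ⟨
    ∣ p - x ∣ + χ p x ∸ 1    ≡⟨ cong (_∸ 1) (∣p∣≡∣p-x∣+χpx p x) ⟨
    ∣ p ∣ ∸ 1                ∎

  χ*∣p-x∣≡χ*∣p∣∸1 : ∀ (p : Subset n) x → χ p x * ∣ p - x ∣ ≡ χ p x * (∣ p ∣ ∸ 1)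
  χ*∣p-x∣≡χ*∣p∣∸1 p x with x ∈? p
  ... | yes x∈p = cong (_+ 0) (∣p-x∣≡∣p∣∸1 x∈p)
  ... | no _    = refl

  χ₂ : Subset n → Fin n → Fin n → ℕ
  χ₂ p y z = χ p y * χ (p - y) z

  orderedPairCount : Subset n → ℕ
  orderedPairCount p = sum (λ y → sum (χ₂ p y))

  orderedPairCount≡∣p∣*∣p∣∸1 : ∀ (p : Subset n) → orderedPairCount p ≡ ∣ p ∣ * (∣ p ∣ ∸ 1)
  orderedPairCount≡∣p∣*∣p∣∸1 p = begin
    sum (λ y → sum (λ z → χ p y * χ (p - y) z))   ≡⟨ sum-cong-≗ (λ y → *-distribˡ-sum (χ p y) (χ (p - y))) ⟨
    sum (λ y → χ p y * sum (χ (p - y)))           ≡⟨ sum-cong-≗ (λ y → cong (χ p y *_) (∣p∣≡∑χ (p - y))) ⟨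
    sum (λ y → χ p y * ∣ p - y ∣)                 ≡⟨ sum-cong-≗ (χ*∣p-x∣≡χ*∣p∣∸1 p) ⟩
    sum (λ y → χ p y * (∣ p ∣ ∸ 1))               ≡⟨ *-distribʳ-sum (∣ p ∣ ∸ 1) (χ p) ⟨
    sum (χ p) * (∣ p ∣ ∸ 1)                       ≡⟨ cong (_* (∣ p ∣ ∸ 1)) (∣p∣≡∑χ p) ⟨
    ∣ p ∣ * (∣ p ∣ ∸ 1)                           ∎

  χ*orderedPairCount[p-x] : ∀ (p : Subset n) x →
                            χ p x * orderedPairCount (p - x) ≡ (∣ p ∣ ∸ 1) * (∣ p ∣ ∸ 2) * χ p x
  χ*orderedPairCount[p-x] p x with x ∈? p
  ... | no _    = sym (*-zeroʳ ((∣ p ∣ ∸ 1) * (∣ p ∣ ∸ 2)))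
  ... | yes x∈p = begin
    orderedPairCount (p - x) + 0              ≡⟨ +-identityʳ _ ⟩
    orderedPairCount (p - x)                  ≡⟨ orderedPairCount≡∣p∣*∣p∣∸1 (p - x) ⟩
    ∣ p - x ∣ * (∣ p - x ∣ ∸ 1)               ≡⟨ cong (λ m → m * (m ∸ 1)) (∣p-x∣≡∣p∣∸1 x∈p) ⟩
    (∣ p ∣ ∸ 1) * (∣ p ∣ ∸ 1 ∸ 1)             ≡⟨ cong ((∣ p ∣ ∸ 1) *_) (∸-+-assoc ∣ p ∣ 1 1) ⟩
    (∣ p ∣ ∸ 1) * (∣ p ∣ ∸ 2)                 ≡⟨ *-identityʳ _ ⟨
    (∣ p ∣ ∸ 1) * (∣ p ∣ ∸ 2) * 1             ∎

  χ⊤≡1 : ∀ x → χ (⊤ {n}) x ≡ 1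
  χ⊤≡1 x = 𝟙-yes (x ∈? ⊤) ∈⊤

  -- Both sides are the indicator of "x, y, z are distinct points of p".
  χ*χ₂[p-x]≡χ₂[⊤-x]*χχχ : ∀ (p : Subset n) x y z →
    χ p x * χ₂ (p - x) y z ≡ χ₂ (⊤ - x) y z * (χ p x * (χ p y * χ p z))
  χ*χ₂[p-x]≡χ₂[⊤-x]*χχχ p x y z
    rewrite χ-─ p x y | χ-─ (p - x) y z | χ-─ p x z
          | χ-─ ⊤ x y | χ-─ (⊤ - x) y z | χ-─ ⊤ x z | χ⊤≡1 y | χ⊤≡1 z
    = rearrange (χ p x) (χ p y) (χ p z) (𝟙 (¬? (y ≟ᶠ x))) (𝟙 (¬? (z ≟ᶠ x))) (𝟙 (¬? (z ≟ᶠ y)))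
    where
    rearrange : ∀ a b c y≢x z≢x z≢y →
                a * (b * y≢x * (c * z≢x * z≢y)) ≡ 1 * y≢x * (1 * z≢x * z≢y) * (a * (b * c))
    rearrange = solve-∀

  ∣⁅x⁆∪p∣≡1+∣p∣ : ∀ {x} {p : Subset n} → x ∉ p → ∣ ⁅ x ⁆ ∪ p ∣ ≡ 1 + ∣ p ∣
  ∣⁅x⁆∪p∣≡1+∣p∣ {x} {p} x∉p = trans (∣p∪q∣≡∣p∣+∣q∣ ⁅x⁆∩p≡∅) (cong (_+ ∣ p ∣) (∣⁅x⁆∣≡1 x))
    where
    ⁅x⁆∩p≡∅ : Empty (⁅ x ⁆ ∩ p)
    ⁅x⁆∩p≡∅ (y , y∈⁅x⁆∩p) with x∈p∩q⁻ ⁅ x ⁆ p y∈⁅x⁆∩p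
    ... | y∈⁅x⁆ , y∈p = x∉p (subst (_∈ˢ p) (x∈⁅y⁆⇒x≡y x y∈⁅x⁆) y∈p)

  ∣⁅x⁆∪⁅y⁆∪⁅z⁆∣≡3 : ∀ {x y z} → x ≢ y → x ≢ z → y ≢ z → ∣ ⁅ x ⁆ ∪ ⁅ y ⁆ ∪ ⁅ z ⁆ ∣ ≡ 3
  ∣⁅x⁆∪⁅y⁆∪⁅z⁆∣≡3 {x} {y} {z} x≢y x≢z y≢z = begin
    ∣ ⁅ x ⁆ ∪ ⁅ y ⁆ ∪ ⁅ z ⁆ ∣   ≡⟨ ∣⁅x⁆∪p∣≡1+∣p∣ ([ x≢y ∘ x∈⁅y⁆⇒x≡y y , x≢z ∘ x∈⁅y⁆⇒x≡y z ] ∘ x∈p∪q⁻ ⁅ y ⁆ ⁅ z ⁆) ⟩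
    1 + ∣ ⁅ y ⁆ ∪ ⁅ z ⁆ ∣       ≡⟨ cong (1 +_) (∣⁅x⁆∪p∣≡1+∣p∣ (y≢z ∘ x∈⁅y⁆⇒x≡y z)) ⟩
    2 + ∣ ⁅ z ⁆ ∣               ≡⟨ cong (2 +_) (∣⁅x⁆∣≡1 z) ⟩
    3                           ∎

  ⁅x⁆∪⁅y⁆∪⁅z⁆⊆p⇔ : ∀ {x y z} {p : Subset n} → ⁅ x ⁆ ∪ ⁅ y ⁆ ∪ ⁅ z ⁆ ⊆ˢ p ⇔ (x ∈ˢ p × y ∈ˢ p × z ∈ˢ p)
  ⁅x⁆∪⁅y⁆∪⁅z⁆⊆p⇔ {x} {y} {z} {p} = mk⇔
    (λ ⊆p → ⊆p (x∈p∪q⁺ (inj₁ (x∈⁅x⁆ x)))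
          , ⊆p (x∈p∪q⁺ (inj₂ (x∈p∪q⁺ (inj₁ (x∈⁅x⁆ y)))))
          , ⊆p (x∈p∪q⁺ (inj₂ (x∈p∪q⁺ (inj₂ (x∈⁅x⁆ z))))))
    (λ (x∈p , y∈p , z∈p) w∈xyz →
       [ (λ w∈⁅x⁆ → subst (_∈ˢ p) (sym (x∈⁅y⁆⇒x≡y x w∈⁅x⁆)) x∈p)
       , [ (λ w∈⁅y⁆ → subst (_∈ˢ p) (sym (x∈⁅y⁆⇒x≡y y w∈⁅y⁆)) y∈p)
         , (λ w∈⁅z⁆ → subst (_∈ˢ p) (sym (x∈⁅y⁆⇒x≡y z w∈⁅z⁆)) z∈p)
         ] ∘ x∈p∪q⁻ ⁅ y ⁆ ⁅ z ⁆
       ] (x∈p∪q⁻ ⁅ x ⁆ (⁅ y ⁆ ∪ ⁅ z ⁆) w∈xyz))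

replicationNumber : ∀ {v b} → (Fin b → Subset v) → Fin v → ℕ
replicationNumber B x = sum (λ i → χ (B i) x)

module _ {v b : ℕ} (B : Fin b → Subset v)
         (steiner : ∀ T → ∣ T ∣ ≡ 3 → ∃! _≡_ (λ i → T ⊆ˢ B i)) where

  ∑χχχ≡1 : ∀ {x y z} → x ≢ y → x ≢ z → y ≢ z →
           sum (λ i → χ (B i) x * (χ (B i) y * χ (B i) z)) ≡ 1
  ∑χχχ≡1 {x} {y} {z} x≢y x≢z y≢z
    with steiner (⁅ x ⁆ ∪ ⁅ y ⁆ ∪ ⁅ z ⁆) (∣⁅x⁆∪⁅y⁆∪⁅z⁆∣≡3 x≢y x≢z y≢z)
  ... | j , xyz⊆Bj , unique = begin
    sum (λ i → χ (B i) x * (χ (B i) y * χ (B i) z))   ≡⟨ sum-cong-≗ 1*𝟙≡χχχ ⟨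
    sum (λ i → 1 * 𝟙 (∈B? i))                         ≡⟨ ∑-sift ∈B? (λ _ → 1) (Equivalence.to ⁅x⁆∪⁅y⁆∪⁅z⁆⊆p⇔ xyz⊆Bj)
                                                             (unique ∘ Equivalence.from ⁅x⁆∪⁅y⁆∪⁅z⁆⊆p⇔) ⟩
    1                                                 ∎
    where
    ∈B? : ∀ i → Dec (x ∈ˢ B i × y ∈ˢ B i × z ∈ˢ B i)
    ∈B? i = x ∈? B i ×-dec y ∈? B i ×-dec z ∈? B i
    1*𝟙≡χχχ : ∀ i → 1 * 𝟙 (∈B? i) ≡ χ (B i) x * (χ (B i) y * χ (B i) z)
    1*𝟙≡χχχ i = begin
      1 * 𝟙 (∈B? i)                                   ≡⟨ *-identityˡ _ ⟩
      𝟙 (∈B? i)                                       ≡⟨ 𝟙-× (x ∈? B i) (y ∈? B i ×-dec z ∈? B i) ⟩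
      χ (B i) x * 𝟙 (y ∈? B i ×-dec z ∈? B i)         ≡⟨ cong (χ (B i) x *_) (𝟙-× (y ∈? B i) (z ∈? B i)) ⟩
      χ (B i) x * (χ (B i) y * χ (B i) z)             ∎

  ∑χ*χ₂[B-x]≡χ₂[⊤-x] : ∀ x y z → sum (λ i → χ (B i) x * χ₂ (B i - x) y z) ≡ χ₂ (⊤ - x) y z
  ∑χ*χ₂[B-x]≡χ₂[⊤-x] x y z = begin
    sum (λ i → χ (B i) x * χ₂ (B i - x) y z)         ≡⟨ sum-cong-≗ (λ i → χ*χ₂[p-x]≡χ₂[⊤-x]*χχχ (B i) x y z) ⟩
    sum (λ i → χ₂ (⊤ - x) y z * χχχ i)               ≡⟨ *-distribˡ-sum (χ₂ (⊤ - x) y z) χχχ ⟨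
    χ₂ (⊤ - x) y z * sum χχχ                         ≡⟨ χ₂*∑χχχ≡χ₂ ⟩
    χ₂ (⊤ - x) y z                                   ∎
    where
    χχχ : Fin b → ℕ
    χχχ i = χ (B i) x * (χ (B i) y * χ (B i) z)
    χ₂*∑χχχ≡χ₂ : χ₂ (⊤ - x) y z * sum χχχ ≡ χ₂ (⊤ - x) y z
    χ₂*∑χχχ≡χ₂ with y ∈? ⊤ - x | z ∈? ⊤ - x - y
    ... | no _      | _           = refl
    ... | yes _     | no _        = refl
    ... | yes y∈⊤-x | yes z∈⊤-x-y = trans (+-identityʳ (sum χχχ)) (∑χχχ≡1 x≢y x≢z y≢z)
      where
      x≢y : x ≢ y
      x≢z : x ≢ z
      y≢z : y ≢ z
      x≢y = ≢-sym (x∈p-y⇒x≢y ⊤ y∈⊤-x)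
      x≢z = ≢-sym (x∈p-y⇒x≢y ⊤ (p─q⊆p (⊤ - x) ⁅ y ⁆ z∈⊤-x-y))
      y≢z = ≢-sym (x∈p-y⇒x≢y (⊤ - x) z∈⊤-x-y)

  replicationNumber-formula : ∀ {k} → (∀ i → ∣ B i ∣ ≡ k) → ∀ x →
                              (k ∸ 1) * (k ∸ 2) * replicationNumber B x ≡ (v ∸ 1) * (v ∸ 2)
  replicationNumber-formula {k} ∣B∣≡k x = begin
    (k ∸ 1) * (k ∸ 2) * sum (λ i → χ (B i) x)
      ≡⟨ *-distribˡ-sum ((k ∸ 1) * (k ∸ 2)) (λ i → χ (B i) x) ⟩
    sum (λ i → (k ∸ 1) * (k ∸ 2) * χ (B i) x)
      ≡⟨ sum-cong-≗ (λ i → trans (χ*orderedPairCount[p-x] (B i) x)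
                                 (cong (λ m → (m ∸ 1) * (m ∸ 2) * χ (B i) x) (∣B∣≡k i))) ⟨
    sum (λ i → χ (B i) x * orderedPairCount (B i - x))
      ≡⟨ sum-cong-≗ (λ i → distribute (χ (B i) x) (χ₂ (B i - x))) ⟩
    sum (λ i → sum (λ y → sum (λ z → χ (B i) x * χ₂ (B i - x) y z)))
      ≡⟨ ∑-comm (λ i y → sum (λ z → χ (B i) x * χ₂ (B i - x) y z)) ⟩
    sum (λ y → sum (λ i → sum (λ z → χ (B i) x * χ₂ (B i - x) y z)))
      ≡⟨ sum-cong-≗ (λ y → ∑-comm (λ i z → χ (B i) x * χ₂ (B i - x) y z)) ⟩
    sum (λ y → sum (λ z → sum (λ i → χ (B i) x * χ₂ (B i - x) y z)))
      ≡⟨ sum-cong-≗ (λ y → sum-cong-≗ (∑χ*χ₂[B-x]≡χ₂[⊤-x] x y)) ⟩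
    orderedPairCount (⊤ - x)
      ≡⟨ orderedPairCount≡∣p∣*∣p∣∸1 (⊤ - x) ⟩
    ∣ ⊤ - x ∣ * (∣ ⊤ - x ∣ ∸ 1)
      ≡⟨ cong (λ m → m * (m ∸ 1)) (trans (∣p-x∣≡∣p∣∸1 {p = ⊤} {x} ∈⊤) (cong (_∸ 1) (∣⊤∣≡n v))) ⟩
    (v ∸ 1) * (v ∸ 1 ∸ 1)
      ≡⟨ cong ((v ∸ 1) *_) (∸-+-assoc v 1 1) ⟩
    (v ∸ 1) * (v ∸ 2) ∎
    where
    distribute : ∀ c (f : Fin v → Fin v → ℕ) → c * sum (λ y → sum (f y)) ≡ sum (λ y → sum (λ z → c * f y z))
    distribute c f = trans (*-distribˡ-sum c (λ y → sum (f y))) (sum-cong-≗ (λ y → *-distribˡ-sum c (f y)))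

lookup-injective : ∀ {a} {A : Set a} {xs : List A} → Unique xs →
                   ∀ {i j} → lookup xs i ≡ lookup xs j → i ≡ j
lookup-injective {xs = x ∷ xs} (x∉xs ∷ _) {zero}  {zero}  _ = refl
lookup-injective {xs = x ∷ xs} (x∉xs ∷ _) {zero}  {suc j} x≡xsⱼ =
  contradiction x≡xsⱼ (All.lookup x∉xs (∈-lookup j))
lookup-injective {xs = x ∷ xs} (x∉xs ∷ _) {suc i} {zero}  xsᵢ≡x =
  contradiction (sym xsᵢ≡x) (All.lookup x∉xs (∈-lookup i))
lookup-injective {xs = x ∷ xs} (_ ∷ unique) {suc i} {suc j} xsᵢ≡xsⱼ =
  cong suc (lookup-injective unique xsᵢ≡xsⱼ)

∑-sift-lookup : ∀ {a} {A : Set a} (_≟_ : DecidableEquality A) {xs : List A} → Unique xs →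
                ∀ {y} → y ∈ xs → (f : A → ℕ) →
                sum (λ k → f (lookup xs k) * 𝟙 (y ≟ lookup xs k)) ≡ f y
∑-sift-lookup _≟_ {xs} unique y∈xs f = trans
  (∑-sift (λ k → _ ≟ lookup xs k) (f ∘ lookup xs) y≡xsⱼ
          (λ y≡xsₖ → lookup-injective unique (trans (sym y≡xsⱼ) y≡xsₖ)))
  (cong f (sym y≡xsⱼ))
  where y≡xsⱼ = lookup-index y∈xs

module _ {v : ℕ} (B : NestedBlock v) where

  ∣block∣≡4 : ∣ block B ∣ ≡ 4
  ∣block∣≡4 = trans (∣p∪q∣≡∣p∣+∣q∣ (disjoint B)) (cong₂ _+_ (size₁ B) (size₂ B))

  pair₁≢pair₂ : pair₁ B ≢ pair₂ B
  pair₁≢pair₂ p₁≡p₂ = 0≢1+n (trans (sym ∣pair₁∣≡0) (size₁ B))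
    where
    pair₁≡∅ : Empty (pair₁ B)
    pair₁≡∅ = subst Empty (∩-idem (pair₁ B)) (subst (λ q → Empty (pair₁ B ∩ q)) (sym p₁≡p₂) (disjoint B))
    ∣pair₁∣≡0 : ∣ pair₁ B ∣ ≡ 0
    ∣pair₁∣≡0 = trans (cong ∣_∣ (Empty-unique pair₁≡∅)) (∣⊥∣≡0 v)

module _ {v : ℕ} (N : NestedSQS v) where

  pairOf? : ∀ P i → Dec (pair₁ (blocks N i) ≡ P ⊎ pair₂ (blocks N i) ≡ P)
  pairOf? P i = (pair₁ (blocks N i) ≟ˢ P) ⊎-dec (pair₂ (blocks N i) ≟ˢ P)

  multiplicity≡∑ : ∀ P → multiplicity N P ≡ sum (λ i → 𝟙 (pairOf? P i))
  multiplicity≡∑ P = length-filter-tabulate (pairOf? P) id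

  1≤multiplicity : ∀ {P} i → pair₁ (blocks N i) ≡ P ⊎ pair₂ (blocks N i) ≡ P → 1 ≤ multiplicity N P
  1≤multiplicity {P} i P∈Bᵢ = subst (1 ≤_) (sym (multiplicity≡∑ P))
    (subst (_≤ sum (λ i → 𝟙 (pairOf? P i))) (𝟙-yes (pairOf? P i) P∈Bᵢ) (∑-≥ (λ i → 𝟙 (pairOf? P i)) i))

  module _ (L : List (Subset v)) (unique : Unique L) (L⇔ND : ∀ P → (P ∈ L) ⇔ IsNDPair N P) where

    pair₁∈L : ∀ i → pair₁ (blocks N i) ∈ L
    pair₁∈L i = Equivalence.from (L⇔ND _) (size₁ (blocks N i) , 1≤multiplicity i (inj₁ refl))

    pair₂∈L : ∀ i → pair₂ (blocks N i) ∈ L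
    pair₂∈L i = Equivalence.from (L⇔ND _) (size₂ (blocks N i) , 1≤multiplicity i (inj₂ refl))

    L[_] : Fin (length L) → Subset v
    L[_] = lookup L

    ndDegree : Fin v → ℕ
    ndDegree x = sum (λ k → χ L[ k ] x)

    χ[block]≡∑ : ∀ i x → χ (block (blocks N i)) x ≡ sum (λ k → χ L[ k ] x * 𝟙 (pairOf? L[ k ] i))
    χ[block]≡∑ i x = begin
      χ (p₁ ∪ p₂) x
        ≡⟨ χ-∪ (disjoint (blocks N i)) x ⟩
      χ p₁ x + χ p₂ x
        ≡⟨ cong₂ _+_ (∑-sift-lookup _≟ˢ_ unique (pair₁∈L i) (λ P → χ P x))
                     (∑-sift-lookup _≟ˢ_ unique (pair₂∈L i) (λ P → χ P x)) ⟨
      sum (λ k → χ L[ k ] x * 𝟙 (p₁ ≟ˢ L[ k ])) + sum (λ k → χ L[ k ] x * 𝟙 (p₂ ≟ˢ L[ k ]))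
        ≡⟨ ∑-distrib-+ (λ k → χ L[ k ] x * 𝟙 (p₁ ≟ˢ L[ k ])) (λ k → χ L[ k ] x * 𝟙 (p₂ ≟ˢ L[ k ])) ⟨
      sum (λ k → χ L[ k ] x * 𝟙 (p₁ ≟ˢ L[ k ]) + χ L[ k ] x * 𝟙 (p₂ ≟ˢ L[ k ]))
        ≡⟨ sum-cong-≗ (λ k → *-distribˡ-+ (χ L[ k ] x) _ _) ⟨
      sum (λ k → χ L[ k ] x * (𝟙 (p₁ ≟ˢ L[ k ]) + 𝟙 (p₂ ≟ˢ L[ k ])))
        ≡⟨ sum-cong-≗ (λ k → cong (χ L[ k ] x *_) (𝟙-⊎ (not-both k) (p₁ ≟ˢ L[ k ]) (p₂ ≟ˢ L[ k ]))) ⟨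
      sum (λ k → χ L[ k ] x * 𝟙 (pairOf? L[ k ] i))
        ∎
      where
      p₁ p₂ : Subset v
      p₁ = pair₁ (blocks N i)
      p₂ = pair₂ (blocks N i)
      not-both : ∀ k → ¬ (p₁ ≡ L[ k ] × p₂ ≡ L[ k ])
      not-both k (p₁≡Lₖ , p₂≡Lₖ) = pair₁≢pair₂ (blocks N i) (trans p₁≡Lₖ (sym p₂≡Lₖ))

    replicationNumber≡ndDegree*μ : ∀ {μ} → UniformWith N μ → ∀ x →
                                   replicationNumber (block ∘ blocks N) x ≡ ndDegree x * μ
    replicationNumber≡ndDegree*μ {μ} uniform x = begin
      sum (λ i → χ (block (blocks N i)) x)
        ≡⟨ sum-cong-≗ (λ i → χ[block]≡∑ i x) ⟩
      sum (λ i → sum (λ k → χ L[ k ] x * 𝟙 (pairOf? L[ k ] i)))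
        ≡⟨ ∑-comm (λ i k → χ L[ k ] x * 𝟙 (pairOf? L[ k ] i)) ⟩
      sum (λ k → sum (λ i → χ L[ k ] x * 𝟙 (pairOf? L[ k ] i)))
        ≡⟨ sum-cong-≗ (λ k → *-distribˡ-sum (χ L[ k ] x) (λ i → 𝟙 (pairOf? L[ k ] i))) ⟨
      sum (λ k → χ L[ k ] x * sum (λ i → 𝟙 (pairOf? L[ k ] i)))
        ≡⟨ sum-cong-≗ (λ k → cong (χ L[ k ] x *_) (multiplicity≡∑ L[ k ])) ⟨
      sum (λ k → χ L[ k ] x * multiplicity N L[ k ])
        ≡⟨ sum-cong-≗ (λ k → cong (χ L[ k ] x *_) (uniform L[ k ] (Equivalence.to (L⇔ND _) (∈-lookup k)))) ⟩
      sum (λ k → χ L[ k ] x * μ)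
        ≡⟨ *-distribʳ-sum μ (λ k → χ L[ k ] x) ⟨
      ndDegree x * μ
        ∎

lemma4p13 : ∀ (v M μ : ℕ) → 0 < v →
    v * (v ∸ 2) ≤ 4 * M → M ≤ v C 2 →
    12 * M * μ ≡ v * (v ∸ 1) * (v ∸ 2) →
    (Σ (NestedSQS v) λ N → HasNDPairCount N M × UniformWith N μ) →
    ∃ λ k → 6 * (μ * k) ≡ (v ∸ 1) * (v ∸ 2)
lemma4p13 (ℕ.suc v) M μ _ _ _ _ (N , (L , unique , _ , L⇔ND) , uniform) = d , (begin
  6 * (μ * d)
    ≡⟨ cong (6 *_) (*-comm μ d) ⟩
  6 * (d * μ)
    ≡⟨ cong (6 *_) (replicationNumber≡ndDegree*μ N L unique L⇔ND uniform x) ⟨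
  6 * replicationNumber (block ∘ blocks N) x
    ≡⟨ replicationNumber-formula (block ∘ blocks N) (steiner N) (∣block∣≡4 ∘ blocks N) x ⟩
  v * (v ∸ 1)
    ∎)
  where
  x : Fin (ℕ.suc v)
  x = zero
  d : ℕ
  d = ndDegree N L unique L⇔ND x
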